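{- Let $G$ be a graph containing no isolated edge, and let $v_iv_j\in E(G)$ be an edge such that the graph $G-v_iv_j$ also contains no isolated edge. Then $$ASO(G)>ASO(G-v_iv_j).$$
   Context: All graphs are finite and simple. An isolated edge of a graph is an edge both of whose endvertices have degree $1$ (equivalently, a connected component isomorphic to the path $P_2$). $G-v_iv_j$ denotes the graph obtained from $G$ by deleting the edge $v_iv_j$ (keeping all vertices). For a graph $H$ with no isolated edge, the augmented Sombor index is $ASO(H)=\sum_{v_rv_s\in E(H)}\sqrt{\frac{d_r^2+d_s^2}{d_r+d_s-2}}$, where $d_r$ denotes the degree of vertex $v_r$ in $H$ and the sum runs over all edges of $H$. -}

module Defs where

open import Data.Bool using (Bool; true; false; if_then_else_; _∧_; _∨_; not)
open import Data.Nat as ℕ using (ℕ; _∸_; _<ᵇ_)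
open import Data.Fin using (Fin; toℕ)
open import Data.Fin.Properties using (_≟_)
open import Data.List using (List; []; _∷_; map; filter; concatMap; foldr)
open import Data.List.Relation.Binary.Pointwise using (Pointwise)
open import Data.Product using (_×_; _,_; proj₁; proj₂; ∃; ∃₂)
open import Data.Sum using (_⊎_)
open import Data.Integer using (+_)
open import Data.Rational as ℚ using (ℚ; 0ℚ; _≤_; _<_; _/_)
open import Relation.Nullary using (¬_)
open import Relation.Nullary.Decidable using (⌊_⌋)
open import Relation.Binary.PropositionalEquality using (_≡_)
open import Data.List using (allFin)

record Graph (n : ℕ) : Set where
  field
    adj     : Fin n → Fin n → Bool
    adj-sym : ∀ u v → adj u v ≡ adj v u
    adj-irr : ∀ v → adj v v ≡ false
open Graph public

degree : ∀ {n} → Graph n → Fin n → ℕ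
degree {n} G v = foldr ℕ._+_ 0 (map (λ u → if adj G v u then 1 else 0) (allFin n))

IsEdge : ∀ {n} → Graph n → Fin n → Fin n → Set
IsEdge G i j = adj G i j ≡ true

NoIsolatedEdge : ∀ {n} → Graph n → Set
NoIsolatedEdge G = ∀ u v → IsEdge G u v → ¬ (degree G u ≡ 1 × degree G v ≡ 1)

deleteEdge : ∀ {n} → Graph n → Fin n → Fin n → Graph n
deleteEdge G i j = record
  { adj = λ u v → adj G u v ∧ not ((⌊ u ≟ i ⌋ ∧ ⌊ v ≟ j ⌋) ∨ (⌊ u ≟ j ⌋ ∧ ⌊ v ≟ i ⌋))
  ; adj-sym = sym'
  ; adj-irr = λ v → irr' v }
  where
  open import Relation.Binary.PropositionalEquality using (cong₂; refl)
  open import Data.Bool.Properties using (∨-comm; ∧-comm)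
  hit : Fin _ → Fin _ → Bool
  hit u v = (⌊ u ≟ i ⌋ ∧ ⌊ v ≟ j ⌋) ∨ (⌊ u ≟ j ⌋ ∧ ⌊ v ≟ i ⌋)
  hit-sym : ∀ u v → hit u v ≡ hit v u
  hit-sym u v rewrite ∧-comm ⌊ u ≟ i ⌋ ⌊ v ≟ j ⌋ | ∧-comm ⌊ u ≟ j ⌋ ⌊ v ≟ i ⌋
    = ∨-comm (⌊ v ≟ j ⌋ ∧ ⌊ u ≟ i ⌋) (⌊ v ≟ i ⌋ ∧ ⌊ u ≟ j ⌋)
  sym' : ∀ u v → adj G u v ∧ not (hit u v) ≡ adj G v u ∧ not (hit v u)
  sym' u v = cong₂ (λ a b → a ∧ not b) (adj-sym G u v) (hit-sym u v)
  irr' : ∀ v → adj G v v ∧ not (hit v v) ≡ false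
  irr' v rewrite adj-irr G v = refl

edges : ∀ {n} → Graph n → List (Fin n × Fin n)
edges {n} G = concatMap (λ u → concatMap (λ v →
  if (toℕ u <ᵇ toℕ v) ∧ adj G u v then (u , v) ∷ [] else []) (allFin n)) (allFin n)

-- A formal sum  Σ_k sqrt(p_k / q_k)  of square roots of nonnegative
-- rationals, represented by the list of pairs (p_k , q_k).
SqrtSum : Set
SqrtSum = List (ℕ × ℕ)

-- rational l is a lower bound of sqrt(p/q)   (q > 0 assumed)
LowerSqrt : ℕ × ℕ → ℚ → Set
LowerSqrt (p , q) l = l ≤ 0ℚ ⊎ (l ℚ.* l ℚ.* (+ q / 1)) ≤ (+ p / 1)

-- rational u is an upper bound of sqrt(p/q)   (q > 0 assumed)
UpperSqrt : ℕ × ℕ → ℚ → Set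
UpperSqrt (p , q) u = 0ℚ ≤ u × (+ p / 1) ≤ (u ℚ.* u ℚ.* (+ q / 1))

sumℚ : List ℚ → ℚ
sumℚ = foldr ℚ._+_ 0ℚ

-- Strict order of real numbers Σ sqrt(a_k) < Σ sqrt(b_k): separated by
-- rational upper bounds of the left terms and lower bounds of the right terms.
_<√_ : SqrtSum → SqrtSum → Set
xs <√ ys = ∃₂ λ us ls → Pointwise UpperSqrt xs us × Pointwise LowerSqrt ys ls
                       × sumℚ us < sumℚ ls

-- ASO(H) = Σ_{v_r v_s ∈ E(H)} sqrt((d_r² + d_s²)/(d_r + d_s - 2))
ASO : ∀ {n} → Graph n → SqrtSum
ASO G = map (λ e → let a = degree G (proj₁ e) ; b = degree G (proj₂ e)
                   in (a ℕ.* a ℕ.+ b ℕ.* b , a ℕ.+ b ∸ 2)) (edges G)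

{-# OPTIONS --safe #-}
-- Fix the precision D = 1 + n(n² + 2n + 3). Each root √(p/q) lies between k/D and (k + 1)/D for
-- k = ⌊D √(p/q)⌋, so it suffices to show that the sum of k + 1 over the edges of G − vᵢvⱼ is below
-- the sum of k over the edges of G.
-- Deleting vᵢvⱼ removes its term and lowers the degrees of vᵢ and vⱼ by one, which changes only the
-- terms of the other edges at vᵢ or vⱼ. When an end degree falls from x to x − 1, the ratio
-- (x² + y²)/(x + y − 2) grows by less than 1, and it was at least x, so the root grows by at most
-- about 1/(2√x). The at most x − 1 edges left at an endpoint of degree x therefore gain less than
-- √x/2, while the deleted term is √((x² + y²)/(x + y − 2)) ≥ √((x + y)/2) ≥ (√x + √y)/2; the
-- precision D leaves room for the n² rounding errors.
module Submission where

open import Data.Bool using (Bool; true; false; if_then_else_; _∧_; _∨_; not; T)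
open import Data.Bool.Properties using (∧-identityʳ; ∨-identityʳ; ∧-zeroʳ)
open import Data.Fin using (Fin; toℕ) renaming (zero to fzero; suc to fsuc)
open import Data.Fin.Properties using (_≟_; toℕ-injective)
import Data.Integer as ℤ
import Data.Integer.Properties as ℤ
open import Data.List using (List; []; _∷_; _++_; map; concatMap; tabulate; allFin)
open import Data.List.Properties using (map-++; map-∘)
open import Data.List.Relation.Binary.Pointwise using (Pointwise; []; _∷_)
open import Data.List.Relation.Unary.All as All using (All; []; _∷_)
open import Data.List.Relation.Unary.All.Properties using (concat⁺; map⁺; tabulate⁺)
open import Data.Nat hiding (_≟_)
open import Data.Nat.DivMod
open import Data.Nat.Divisibility using (n∣m*n)
open import Data.Nat.ListAction using (sum)
open import Data.Nat.ListAction.Properties using (sum-++)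
open import Data.Nat.Properties hiding (_≟_)
open import Data.Nat.Tactic.RingSolver using (solve-∀)
open import Algebra.Properties.Semiring.Sum +-*-semiring
  using (sum-syntax; ∑-distrib-+; ∑-comm; sum-cong-≗; *-distribʳ-sum; sum-replicate-zero)
open import Data.Product using (_×_; _,_; proj₁; proj₂)
open import Data.Rational as ℚ using (ℚ; 0ℚ; toℚᵘ)
import Data.Rational.Properties as ℚ
open import Data.Rational.Unnormalised as ℚᵘ using (ℚᵘ; mkℚᵘ; *≡*; *≤*; *<*)
import Data.Rational.Unnormalised.Properties as ℚᵘ
open import Data.Sum using (_⊎_; inj₁; inj₂)
open import Function using (_∘_; case_of_)
open import Relation.Binary.Definitions using (tri<; tri≈; tri>)
open import Relation.Binary.PropositionalEquality
open import Relation.Nullary using (Dec; yes; no; ¬_)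
open import Relation.Nullary.Decidable using (⌊_⌋)
open import Relation.Nullary.Negation using (contradiction)

open import Defs

⌊√_⌋ : ℕ → ℕ
⌊√ zero ⌋ = zero
⌊√ suc m ⌋ with suc ⌊√ m ⌋ * suc ⌊√ m ⌋ ≤? suc m
... | yes _ = suc ⌊√ m ⌋
... | no _  = ⌊√ m ⌋

n²<[1+n]² : ∀ n → n * n < suc n * suc n
n²<[1+n]² n = *-mono-< (n<1+n n) (n<1+n n)

⌊√⌋-spec : ∀ m → ⌊√ m ⌋ * ⌊√ m ⌋ ≤ m × m < suc ⌊√ m ⌋ * suc ⌊√ m ⌋
⌊√⌋-spec zero = z≤n , s≤s z≤n
⌊√⌋-spec (suc m) with ⌊√⌋-spec m | suc ⌊√ m ⌋ * suc ⌊√ m ⌋ ≤? suc m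
... | _ , m<s² | yes s²≤1+m = s²≤1+m , ≤-<-trans m<s² (n²<[1+n]² (suc ⌊√ m ⌋))
... | r²≤m , _ | no s²≰1+m = m≤n⇒m≤1+n r²≤m , ≰⇒> s²≰1+m

⌊√⌋²≤ : ∀ m → ⌊√ m ⌋ * ⌊√ m ⌋ ≤ m
⌊√⌋²≤ m = proj₁ (⌊√⌋-spec m)

<[1+⌊√⌋]² : ∀ m → m < suc ⌊√ m ⌋ * suc ⌊√ m ⌋
<[1+⌊√⌋]² m = proj₂ (⌊√⌋-spec m)

m²<n²⇒m<n : ∀ {m n} → m * m < n * n → m < n
m²<n²⇒m<n {m} {n} m²<n² with n ≤? m
... | yes n≤m = contradiction (*-mono-≤ n≤m n≤m) (<⇒≱ m²<n²)
... | no n≰m  = ≰⇒> n≰m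

m²≤n²⇒m≤n : ∀ {m n} → m * m ≤ n * n → m ≤ n
m²≤n²⇒m≤n {n = n} m²≤n² = <⇒≤pred (m²<n²⇒m<n (≤-<-trans m²≤n² (n²<[1+n]² n)))

≤⌊√⌋ : ∀ {s m} → s * s ≤ m → s ≤ ⌊√ m ⌋
≤⌊√⌋ {m = m} s²≤m = <⇒≤pred (m²<n²⇒m<n (≤-<-trans s²≤m (<[1+⌊√⌋]² m)))

⌊√⌋≤ : ∀ {s m} → m < suc s * suc s → ⌊√ m ⌋ ≤ s
⌊√⌋≤ {m = m} m<[1+s]² = <⇒≤pred (m²<n²⇒m<n (≤-<-trans (⌊√⌋²≤ m) m<[1+s]²))

⌊√⌋-mono-≤ : ∀ {m n} → m ≤ n → ⌊√ m ⌋ ≤ ⌊√ n ⌋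
⌊√⌋-mono-≤ {m} m≤n = ≤⌊√⌋ (≤-trans (⌊√⌋²≤ m) m≤n)

⌊√+⌋≤⌊√⌋+ : ∀ {m n e a g} → m ≤ n + e → a ≤ ⌊√ n ⌋ → e < 2 * a * g → ⌊√ m ⌋ ≤ ⌊√ n ⌋ + g
⌊√+⌋≤⌊√⌋+ {m} {n} {e} {a} {g} m≤n+e a≤√n e<2ag = ⌊√⌋≤ (begin-strict
    m                          ≤⟨ m≤n+e ⟩
    n + e                      <⟨ +-mono-< (<[1+⌊√⌋]² n) (<-≤-trans e<2ag 2ag≤2gs) ⟩
    s * s + 2 * g * s          ≤⟨ m≤m+n _ (g * g) ⟩
    s * s + 2 * g * s + g * g  ≡⟨ square-expand s g ⟩
    (s + g) * (s + g)          ∎)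
  where
  open ≤-Reasoning
  s = suc ⌊√ n ⌋
  square-expand : ∀ s g → s * s + 2 * g * s + g * g ≡ (s + g) * (s + g)
  square-expand = solve-∀
  2ag≤2gs : 2 * a * g ≤ 2 * g * s
  2ag≤2gs = ≤-trans (≤-reflexive (swap a g)) (*-monoʳ-≤ (2 * g) (m≤n⇒m≤1+n a≤√n))
    where
    swap : ∀ a g → 2 * a * g ≡ 2 * g * a
    swap = solve-∀

m<[1+m/n]*n : ∀ m n .{{_ : NonZero n}} → m < suc (m / n) * n
m<[1+m/n]*n m n = begin-strict
  m                  ≡⟨ m≡m%n+[m/n]*n m n ⟩
  m % n + m / n * n  <⟨ +-monoˡ-< (m / n * n) (m%n<n m n) ⟩
  n + m / n * n      ∎
  where open ≤-Reasoning

*≤⇒≤/ : ∀ k m n .{{_ : NonZero n}} → k * n ≤ m → k ≤ m / n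
*≤⇒≤/ k m n kn≤m with k ≤? m / n
... | yes k≤m/n = k≤m/n
... | no k≰m/n  = contradiction (≤-trans (*-monoˡ-≤ n (≰⇒> k≰m/n)) kn≤m) (<⇒≱ (m<[1+m/n]*n m n))

/-cross-≤ : ∀ a b c d .{{_ : NonZero c}} .{{_ : NonZero d}} → a * d ≤ b * c → a / c ≤ b / d
/-cross-≤ a b c d ad≤bc = *≤⇒≤/ (a / c) b d (*-cancelʳ-≤ _ _ c (begin
  a / c * d * c    ≡⟨ swap-last (a / c) d c ⟩
  a / c * c * d    ≤⟨ *-monoˡ-≤ d (m/n*n≤m a c) ⟩
  a * d            ≤⟨ ad≤bc ⟩
  b * c            ∎))
  where
  open ≤-Reasoning
  swap-last : ∀ x y z → x * y * z ≡ x * z * y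
  swap-last = solve-∀

[m+k*n]/n≡m/n+k : ∀ m k n .{{_ : NonZero n}} → (m + k * n) / n ≡ m / n + k
[m+k*n]/n≡m/n+k m k n = trans (+-distrib-/-∣ʳ m (n∣m*n k)) (cong (m / n +_) (m*n/n≡m k n))

m+k≡n⇒m≤n : ∀ {m n} k → m + k ≡ n → m ≤ n
m+k≡n⇒m≤n {m} k refl = m≤m+n m k

[m+n]²≤2[m²+n²] : ∀ m n → (m + n) * (m + n) ≤ 2 * (m * m + n * n)
[m+n]²≤2[m²+n²] m n with ≤-total m n
... | inj₁ m≤n with m≤n⇒∃[o]m+o≡n m≤n
...   | t , refl = m+k≡n⇒m≤n (t * t) (expand m t)
  where
  expand : ∀ m t → (m + (m + t)) * (m + (m + t)) + t * t ≡ 2 * (m * m + (m + t) * (m + t))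
  expand = solve-∀
[m+n]²≤2[m²+n²] m n | inj₂ n≤m with m≤n⇒∃[o]m+o≡n n≤m
...   | t , refl = m+k≡n⇒m≤n (t * t) (expand n t)
  where
  expand : ∀ n t → (n + t + n) * (n + t + n) + t * t ≡ 2 * ((n + t) * (n + t) + n * n)
  expand = solve-∀

RatioStep : (x p₁ q₁ p₂ q₂ : ℕ) → Set
RatioStep x p₁ q₁ p₂ q₂ = p₁ * q₂ ≤ p₂ * q₁ ⊎ (p₁ * q₂ ≤ p₂ * q₁ + q₁ * q₂ × x * q₂ ≤ p₂)

-- The ratios (a² + b²)/q and ((a+1)² + b²)/(q+1) for q = a + b - 2 = r + 1.
SquaredStep : ℕ → ℕ → ℕ → Set
SquaredStep a b r = RatioStep (suc a) (a * a + b * b) (suc r) (suc a * suc a + b * b) (2 + r)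

-- The ratio grows with a when b ≤ a; when a < b it may drop, but by less than 1.
squared-step : ∀ a b r → 1 ≤ a → 1 ≤ b → 3 + r ≡ a + b → SquaredStep a b r
squared-step (suc c) (suc d) r _ _ 3+r≡a+b with <-cmp c d
... | tri> _ _ d<c with m≤n⇒∃[o]m+o≡n d<c
...   | t , refl =
  subst (SquaredStep (suc (suc d + t)) (suc d)) (+-cancelˡ-≡ 3 _ r (trans (shift d t) (sym 3+r≡a+b)))
        (inj₁ (m+k≡n⇒m≤n _ (expand d t)))
  where
  shift : ∀ d t → 3 + (d + t + d) ≡ suc (suc d + t) + suc d
  shift = solve-∀
  expand : ∀ d t → let a = suc (suc d + t) ; b = suc d ; r = d + t + d in
           (a * a + b * b) * (2 + r) + (6 * d + 4 * d * t + 2 * d * d + 3 * t + t * t)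
           ≡ (suc a * suc a + b * b) * (1 + r)
  expand = solve-∀
squared-step (suc zero) (suc zero) r _ _ () | tri≈ _ refl _
squared-step (suc (suc e)) (suc (suc e)) r _ _ 3+r≡a+b | tri≈ _ refl _ =
  subst (SquaredStep (suc (suc e)) (suc (suc e))) (+-cancelˡ-≡ 3 _ r (trans (shift e) (sym 3+r≡a+b)))
        (inj₁ (m+k≡n⇒m≤n _ (expand e)))
  where
  shift : ∀ e → 3 + suc (e + e) ≡ suc (suc e) + suc (suc e)
  shift = solve-∀
  expand : ∀ e → let a = suc (suc e) ; r = suc (e + e) in
           (a * a + a * a) * (2 + r) + (2 + 6 * e + 2 * e * e) ≡ (suc a * suc a + a * a) * (1 + r)
  expand = solve-∀
squared-step (suc c) (suc d) r _ _ 3+r≡a+b | tri< c<d _ _ with m≤n⇒∃[o]m+o≡n c<d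
...   | t , refl =
  subst (SquaredStep (suc c) (suc (suc c + t))) (+-cancelˡ-≡ 3 _ r (trans (shift c t) (sym 3+r≡a+b)))
        (inj₂ (m+k≡n⇒m≤n _ (expand₁ c t) , m+k≡n⇒m≤n _ (expand₂ c t)))
  where
  shift : ∀ c t → 3 + (c + t + c) ≡ suc c + suc (suc c + t)
  shift = solve-∀
  expand₁ : ∀ c t → let a = suc c ; b = suc (suc c + t) ; r = c + t + c in
            (a * a + b * b) * (2 + r) + (8 * c + 4 * c * t + 6 * c * c + 2 * t)
            ≡ (suc a * suc a + b * b) * (1 + r) + (1 + r) * (2 + r)
  expand₁ = solve-∀
  expand₂ : ∀ c t → let a = suc c ; b = suc (suc c + t) ; r = c + t + c in
            suc a * (2 + r) + (4 + 2 * c + c * t + 2 * t + t * t) ≡ suc a * suc a + b * b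
  expand₂ = solve-∀

module Precision (Dm : ℕ) where

  D D² : ℕ
  D  = suc Dm
  D² = D * D

  -- ⌊D √(p/q)⌋, reading q = 0 as q = 1.
  scaledSqrt : ℕ → ℕ → ℕ
  scaledSqrt p q = ⌊√ (D² * p / suc (pred q)) ⌋

  scaledSqrt²*q≤ : ∀ p q → scaledSqrt p q * scaledSqrt p q * q ≤ D² * p
  scaledSqrt²*q≤ p q = begin
      k * k * q          ≤⟨ *-monoʳ-≤ (k * k) (q≤1+pred q) ⟩
      k * k * suc (pred q) ≤⟨ *-monoˡ-≤ (suc (pred q)) (⌊√⌋²≤ (D² * p / suc (pred q))) ⟩
      D² * p / suc (pred q) * suc (pred q) ≤⟨ m/n*n≤m (D² * p) (suc (pred q)) ⟩
      D² * p             ∎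
    where
    open ≤-Reasoning
    k = scaledSqrt p q
    q≤1+pred : ∀ q → q ≤ suc (pred q)
    q≤1+pred zero    = z≤n
    q≤1+pred (suc q) = ≤-refl

  <[1+scaledSqrt]²*q : ∀ p r → D² * p < suc (scaledSqrt p (suc r)) * suc (scaledSqrt p (suc r)) * suc r
  <[1+scaledSqrt]²*q p r =
    <-≤-trans (m<[1+m/n]*n (D² * p) (suc r)) (*-monoˡ-≤ (suc r) (<[1+⌊√⌋]² (D² * p / suc r)))

  scaledSqrt-mono : ∀ p₁ p₂ r₁ r₂ → p₁ * suc r₂ ≤ p₂ * suc r₁ →
                    scaledSqrt p₁ (suc r₁) ≤ scaledSqrt p₂ (suc r₂)
  scaledSqrt-mono p₁ p₂ r₁ r₂ le = ⌊√⌋-mono-≤ (/-cross-≤ (D² * p₁) (D² * p₂) (suc r₁) (suc r₂) (begin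
      D² * p₁ * suc r₂    ≡⟨ *-assoc D² p₁ (suc r₂) ⟩
      D² * (p₁ * suc r₂)  ≤⟨ *-monoʳ-≤ D² le ⟩
      D² * (p₂ * suc r₁)  ≡⟨ *-assoc D² p₂ (suc r₁) ⟨
      D² * p₂ * suc r₁    ∎))
    where open ≤-Reasoning

  -- root x ≈ D √x, and slope x ≈ D / (2 √x) bounds the growth of D √t for t ≥ x.
  root slope : ℕ → ℕ
  root x  = ⌊√ (x * D²) ⌋
  slope x = D² / suc (pred (2 * root x)) + 1

  1≤root : ∀ {x} → 1 ≤ x → 1 ≤ root x
  1≤root 1≤x = ≤⌊√⌋ (*-mono-≤ 1≤x (s≤s z≤n))

  slope-spec : ∀ {x} → 1 ≤ x → D² < 2 * root x * slope x × 2 * root x * slope x ≤ D² + 2 * root x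
  slope-spec {x} 1≤x with root x | 1≤root 1≤x
  ... | suc a | _ = lower , upper
    where
    m = 2 * suc a
    k = D² / m
    m[k+1]≡[1+k]m : m * (k + 1) ≡ suc k * m
    m[k+1]≡[1+k]m = trans (*-comm m (k + 1)) (cong (_* m) (+-comm k 1))
    lower : D² < m * (k + 1)
    lower = subst (D² <_) (sym m[k+1]≡[1+k]m) (m<[1+m/n]*n D² m)
    upper : m * (k + 1) ≤ D² + m
    upper = begin
      m * (k + 1)    ≡⟨ trans (*-distribˡ-+ m k 1) (cong₂ _+_ (*-comm m k) (*-identityʳ m)) ⟩
      k * m + m      ≤⟨ +-monoˡ-≤ m (m/n*n≤m D² m) ⟩
      D² + m         ∎
      where open ≤-Reasoning

  scaledSqrt-≤-+slope : ∀ x p₁ p₂ r₁ r₂ → 1 ≤ x →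
    p₁ * suc r₂ ≤ p₂ * suc r₁ + suc r₁ * suc r₂ → x * suc r₂ ≤ p₂ →
    scaledSqrt p₁ (suc r₁) ≤ scaledSqrt p₂ (suc r₂) + slope x
  scaledSqrt-≤-+slope x p₁ p₂ r₁ r₂ 1≤x le x≤p₂/q₂ =
    ⌊√+⌋≤⌊√⌋+ ratio-≤ root≤ (proj₁ (slope-spec 1≤x))
    where
    open ≤-Reasoning
    q₁ = suc r₁
    q₂ = suc r₂
    ratio-≤ : D² * p₁ / q₁ ≤ D² * p₂ / q₂ + D²
    ratio-≤ = begin
      D² * p₁ / q₁              ≤⟨ /-cross-≤ (D² * p₁) (D² * p₂ + D² * q₂) q₁ q₂ (begin
          D² * p₁ * q₂               ≡⟨ *-assoc D² p₁ q₂ ⟩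
          D² * (p₁ * q₂)             ≤⟨ *-monoʳ-≤ D² le ⟩
          D² * (p₂ * q₁ + q₁ * q₂)   ≡⟨ distribute D² p₂ q₁ q₂ ⟩
          (D² * p₂ + D² * q₂) * q₁   ∎) ⟩
      (D² * p₂ + D² * q₂) / q₂  ≡⟨ [m+k*n]/n≡m/n+k (D² * p₂) D² q₂ ⟩
      D² * p₂ / q₂ + D²         ∎
      where
      distribute : ∀ d p q₁ q₂ → d * (p * q₁ + q₁ * q₂) ≡ (d * p + d * q₂) * q₁
      distribute = solve-∀
    root≤ : root x ≤ ⌊√ (D² * p₂ / q₂) ⌋
    root≤ = ⌊√⌋-mono-≤ (*≤⇒≤/ (x * D²) (D² * p₂) q₂ (begin
      x * D² * q₂    ≡⟨ rearrange x D² q₂ ⟩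
      D² * (x * q₂)  ≤⟨ *-monoʳ-≤ D² x≤p₂/q₂ ⟩
      D² * p₂        ∎))
      where
      rearrange : ∀ x d q → x * d * q ≡ d * (x * q)
      rearrange = solve-∀

  term : ℕ → ℕ → ℕ
  term a b = scaledSqrt (a * a + b * b) (a + b ∸ 2)

  term-comm : ∀ a b → term a b ≡ term b a
  term-comm a b = cong₂ scaledSqrt (+-comm (a * a) (b * b)) (cong (_∸ 2) (+-comm a b))

  scaledSqrt-step : ∀ x p₁ p₂ r₁ r₂ → 1 ≤ x → RatioStep x p₁ (suc r₁) p₂ (suc r₂) →
                    scaledSqrt p₁ (suc r₁) ≤ scaledSqrt p₂ (suc r₂) + slope x
  scaledSqrt-step x p₁ p₂ r₁ r₂ _ (inj₁ le) =
    ≤-trans (scaledSqrt-mono p₁ p₂ r₁ r₂ le) (m≤m+n _ (slope x))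
  scaledSqrt-step x p₁ p₂ r₁ r₂ 1≤x (inj₂ (le , x≤p₂)) =
    scaledSqrt-≤-+slope x p₁ p₂ r₁ r₂ 1≤x le x≤p₂

  term≤term[1+a]+slope : ∀ {a b} → 1 ≤ a → 1 ≤ b → 3 ≤ a + b → term a b ≤ term (suc a) b + slope (suc a)
  term≤term[1+a]+slope {a} {b} 1≤a 1≤b 3≤a+b with m≤n⇒∃[o]m+o≡n 3≤a+b
  ... | r , 3+r≡a+b =
    subst₂ (λ q₁ q₂ → scaledSqrt p₁ q₁ ≤ scaledSqrt p₂ q₂ + slope (suc a))
           (cong (_∸ 2) 3+r≡a+b) (cong (_∸ 1) 3+r≡a+b)
           (scaledSqrt-step (suc a) p₁ p₂ r (suc r) (s≤s z≤n) (squared-step a b r 1≤a 1≤b 3+r≡a+b))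
    where
    p₁ = a * a + b * b
    p₂ = suc a * suc a + b * b

  module _ (n : ℕ) (n-bound : n * (n * n + 2 * n + 3) ≤ Dm) where

    root≤n*D : ∀ {a} → 1 ≤ a → a ≤ n → root a ≤ n * D
    root≤n*D {a} 1≤a a≤n = m²≤n²⇒m≤n (begin
      root a * root a  ≤⟨ ⌊√⌋²≤ (a * D²) ⟩
      a * D²           ≤⟨ *-monoˡ-≤ D² a≤n ⟩
      n * D²           ≤⟨ *-monoˡ-≤ D² (m≤m*n n n {{>-nonZero (≤-trans 1≤a a≤n)}}) ⟩
      n * n * D²       ≡⟨ regroup n D ⟩
      n * D * (n * D)  ∎)
      where
      open ≤-Reasoning
      regroup : ∀ n D → n * n * (D * D) ≡ n * D * (n * D)
      regroup = solve-∀

    -- 2 x slope (x + 1) ≈ D x / √(x + 1) falls short of D √(x + 1) by about D / √(x + 1) > n² + 1.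
    2x*slope+n²+1<root : ∀ x → suc x ≤ n → 2 * x * slope (suc x) + (n * n + 1) < root (suc x)
    2x*slope+n²+1<root x 1+x≤n = *-cancelˡ-< ρ _ _ (+-cancelʳ-< D² _ _ (begin-strict
        ρ * (2 * x * σ + δ) + D²              ≡⟨ e₁ ρ x σ δ D² ⟩
        x * (2 * ρ * σ) + ρ * δ + D²          ≤⟨ +-monoˡ-≤ D² (+-monoˡ-≤ (ρ * δ) (*-monoʳ-≤ x 2ρσ≤)) ⟩
        x * (D² + 2 * ρ) + ρ * δ + D²         ≡⟨ e₂ ρ x δ D² ⟩
        suc x * D² + (2 * ρ * x + ρ * δ)      <⟨ +-monoˡ-< _ (<[1+⌊√⌋]² (suc x * D²)) ⟩
        suc ρ * suc ρ + (2 * ρ * x + ρ * δ)   ≡⟨ e₃ ρ x δ ⟩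
        ρ * ρ + (2 * ρ + 1 + 2 * ρ * x + ρ * δ) ≤⟨ +-monoʳ-≤ (ρ * ρ) margin ⟩
        ρ * ρ + D²                            ∎))
      where
      open ≤-Reasoning
      ρ = root (suc x)
      σ = slope (suc x)
      δ = n * n + 1
      2ρσ≤ : 2 * ρ * σ ≤ D² + 2 * ρ
      2ρσ≤ = proj₂ (slope-spec {suc x} (s≤s z≤n))
      e₁ : ∀ ρ x σ δ d → ρ * (2 * x * σ + δ) + d ≡ x * (2 * ρ * σ) + ρ * δ + d
      e₁ = solve-∀
      e₂ : ∀ ρ x δ d → x * (d + 2 * ρ) + ρ * δ + d ≡ suc x * d + (2 * ρ * x + ρ * δ)
      e₂ = solve-∀
      e₃ : ∀ ρ x δ → suc ρ * suc ρ + (2 * ρ * x + ρ * δ) ≡ ρ * ρ + (2 * ρ + 1 + 2 * ρ * x + ρ * δ)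
      e₃ = solve-∀
      margin : 2 * ρ + 1 + 2 * ρ * x + ρ * δ ≤ D²
      margin = begin
        2 * ρ + 1 + 2 * ρ * x + ρ * δ      ≡⟨ f₁ ρ x n ⟩
        ρ * (2 * x + n * n + 3) + 1         ≤⟨ +-monoˡ-≤ 1 (*-mono-≤ (root≤n*D (s≤s z≤n) 1+x≤n)
                                                  (+-monoˡ-≤ 3 (+-monoˡ-≤ (n * n) (*-monoʳ-≤ 2 (<⇒≤ 1+x≤n))))) ⟩
        n * D * (2 * n + n * n + 3) + 1     ≡⟨ f₂ n D ⟩
        D * (n * (n * n + 2 * n + 3)) + 1   ≤⟨ +-mono-≤ (*-monoʳ-≤ D n-bound) (s≤s z≤n) ⟩
        D * Dm + D                          ≡⟨ trans (+-comm (D * Dm) D) (sym (*-suc D Dm)) ⟩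
        D²                                  ∎
        where
        f₁ : ∀ ρ x n → 2 * ρ + 1 + 2 * ρ * x + ρ * (n * n + 1) ≡ ρ * (2 * x + n * n + 3) + 1
        f₁ = solve-∀
        f₂ : ∀ n D → n * D * (2 * n + n * n + 3) + 1 ≡ D * (n * (n * n + 2 * n + 3)) + 1
        f₂ = solve-∀

    -- D √((a² + b²)/(a + b - 2)) ≥ D √((a + b)/2) ≥ (root a + root b)/2.
    n²+x*slope+y*slope<term : ∀ x y → suc x ≤ n → suc y ≤ n →
      n * n + x * slope (suc x) + y * slope (suc y) < term (suc x) (suc y)
    n²+x*slope+y*slope<term x y 1+x≤n 1+y≤n = ≤⌊√⌋ (*≤⇒≤/ (suc t * suc t) (D² * p) q̂ (*-cancelˡ-≤ 4 (begin
        4 * (suc t * suc t * q̂)          ≡⟨ e₁ (suc t) q̂ ⟩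
        (2 * suc t) * (2 * suc t) * q̂    ≤⟨ *-mono-≤ (*-mono-≤ 2[1+t]≤ 2[1+t]≤) q̂≤a+b ⟩
        (ρ + ρ′) * (ρ + ρ′) * (a + b)    ≤⟨ *-monoˡ-≤ (a + b) ([m+n]²≤2[m²+n²] ρ ρ′) ⟩
        2 * (ρ * ρ + ρ′ * ρ′) * (a + b)  ≤⟨ *-monoˡ-≤ (a + b) (*-monoʳ-≤ 2 ρ²+ρ′²≤) ⟩
        2 * (a * D² + b * D²) * (a + b)  ≡⟨ e₂ a b D² ⟩
        2 * D² * ((a + b) * (a + b))     ≤⟨ *-monoʳ-≤ (2 * D²) ([m+n]²≤2[m²+n²] a b) ⟩
        2 * D² * (2 * p)                 ≡⟨ e₃ D² p ⟩
        4 * (D² * p)                     ∎)))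
      where
      open ≤-Reasoning
      a = suc x
      b = suc y
      t = n * n + x * slope a + y * slope b
      p = a * a + b * b
      q̂ = suc (pred (a + b ∸ 2))
      ρ = root a
      ρ′ = root b
      ρ²+ρ′²≤ : ρ * ρ + ρ′ * ρ′ ≤ a * D² + b * D²
      ρ²+ρ′²≤ = +-mono-≤ (⌊√⌋²≤ (a * D²)) (⌊√⌋²≤ (b * D²))
      2[1+t]≤ : 2 * suc t ≤ ρ + ρ′
      2[1+t]≤ = begin
        2 * suc t
          ≡⟨ e₀ n x y (slope a) (slope b) ⟩
        (2 * x * slope a + (n * n + 1)) + (2 * y * slope b + (n * n + 1))
          ≤⟨ +-mono-≤ (<⇒≤ (2x*slope+n²+1<root x 1+x≤n)) (<⇒≤ (2x*slope+n²+1<root y 1+y≤n)) ⟩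
        ρ + ρ′ ∎
        where
        e₀ : ∀ n x y σ σ′ → 2 * suc (n * n + x * σ + y * σ′) ≡ (2 * x * σ + (n * n + 1)) + (2 * y * σ′ + (n * n + 1))
        e₀ = solve-∀
      q̂≤a+b : q̂ ≤ a + b
      q̂≤a+b = 1+pred[m∸2]≤1+m (x + b)
        where
        1+pred[m∸2]≤1+m : ∀ m → suc (pred (suc m ∸ 2)) ≤ suc m
        1+pred[m∸2]≤1+m zero          = ≤-refl
        1+pred[m∸2]≤1+m (suc zero)    = s≤s z≤n
        1+pred[m∸2]≤1+m (suc (suc m)) = s≤s (m≤n⇒m≤1+n (n≤1+n m))
      e₁ : ∀ s q → 4 * (s * s * q) ≡ (2 * s) * (2 * s) * q
      e₁ = solve-∀
      e₂ : ∀ a b d → 2 * (a * d + b * d) * (a + b) ≡ 2 * d * ((a + b) * (a + b))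
      e₂ = solve-∀
      e₃ : ∀ d p → 2 * d * (2 * p) ≡ 4 * (d * p)
      e₃ = solve-∀

  scaled : ℕ → ℚ
  scaled k = ℤ.+ k ℚ./ D

  private
    ⟦_/1+_⟧ : ℕ → ℕ → ℚᵘ
    ⟦ a /1+ c ⟧ = mkℚᵘ (ℤ.+ a) c

    toℚᵘ-/ : ∀ a c → toℚᵘ (ℤ.+ a ℚ./ suc c) ℚᵘ.≃ ⟦ a /1+ c ⟧
    toℚᵘ-/ a c = ℚ.toℚᵘ-fromℚᵘ ⟦ a /1+ c ⟧

    ⟦⟧-≤ : ∀ {a b c d} → a * suc d ≤ b * suc c → ⟦ a /1+ c ⟧ ℚᵘ.≤ ⟦ b /1+ d ⟧
    ⟦⟧-≤ {a} {b} {c} {d} le = *≤* (subst₂ ℤ._≤_ (ℤ.pos-* a (suc d)) (ℤ.pos-* b (suc c)) (ℤ.+≤+ le))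

    ⟦⟧-< : ∀ {a b c d} → a * suc d < b * suc c → ⟦ a /1+ c ⟧ ℚᵘ.< ⟦ b /1+ d ⟧
    ⟦⟧-< {a} {b} {c} {d} lt = *<* (subst₂ ℤ._<_ (ℤ.pos-* a (suc d)) (ℤ.pos-* b (suc c)) (ℤ.+<+ lt))

    ⟦⟧-* : ∀ a b c d → (⟦ a /1+ c ⟧ ℚᵘ.* ⟦ b /1+ d ⟧) ℚᵘ.≃ ⟦ a * b /1+ pred (suc c * suc d) ⟧
    ⟦⟧-* a b c d = *≡* (cong (ℤ._* (ℤ.+ (suc c * suc d))) (sym (ℤ.pos-* a b)))

    ⟦⟧-+ : ∀ a b c → (⟦ a /1+ c ⟧ ℚᵘ.+ ⟦ b /1+ c ⟧) ℚᵘ.≃ ⟦ a + b /1+ c ⟧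
    ⟦⟧-+ a b c = *≡* (begin
        (ℤ.+ a ℤ.* ℤ.+ C ℤ.+ ℤ.+ b ℤ.* ℤ.+ C) ℤ.* ℤ.+ C
          ≡⟨ cong (ℤ._* ℤ.+ C) (cong₂ ℤ._+_ (sym (ℤ.pos-* a C)) (sym (ℤ.pos-* b C))) ⟩
        ℤ.+ (a * C + b * C) ℤ.* ℤ.+ C  ≡⟨ sym (ℤ.pos-* (a * C + b * C) C) ⟩
        ℤ.+ ((a * C + b * C) * C)      ≡⟨ cong ℤ.+_ (regroup a b C) ⟩
        ℤ.+ ((a + b) * (C * C))        ≡⟨ ℤ.pos-* (a + b) (C * C) ⟩
        ℤ.+ (a + b) ℤ.* ℤ.+ (C * C)    ∎)
      where
      open ≡-Reasoning
      C = suc c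
      regroup : ∀ a b c → (a * c + b * c) * c ≡ (a + b) * (c * c)
      regroup = solve-∀

    scaled²*q≃ : ∀ k q → toℚᵘ (scaled k ℚ.* scaled k ℚ.* (ℤ.+ q ℚ./ 1)) ℚᵘ.≃ ⟦ k * k * q /1+ pred D² ⟧
    scaled²*q≃ k q = begin
      toℚᵘ (scaled k ℚ.* scaled k ℚ.* (ℤ.+ q ℚ./ 1))
        ≈⟨ ℚ.toℚᵘ-homo-* (scaled k ℚ.* scaled k) (ℤ.+ q ℚ./ 1) ⟩
      toℚᵘ (scaled k ℚ.* scaled k) ℚᵘ.* toℚᵘ (ℤ.+ q ℚ./ 1)
        ≈⟨ ℚᵘ.*-cong (ℚ.toℚᵘ-homo-* (scaled k) (scaled k)) (toℚᵘ-/ q 0) ⟩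
      toℚᵘ (scaled k) ℚᵘ.* toℚᵘ (scaled k) ℚᵘ.* ⟦ q /1+ 0 ⟧
        ≈⟨ ℚᵘ.*-congʳ (ℚᵘ.*-cong (toℚᵘ-/ k Dm) (toℚᵘ-/ k Dm)) ⟩
      ⟦ k /1+ Dm ⟧ ℚᵘ.* ⟦ k /1+ Dm ⟧ ℚᵘ.* ⟦ q /1+ 0 ⟧
        ≈⟨ ℚᵘ.*-congʳ (⟦⟧-* k k Dm Dm) ⟩
      ⟦ k * k /1+ pred D² ⟧ ℚᵘ.* ⟦ q /1+ 0 ⟧
        ≈⟨ ⟦⟧-* (k * k) q (pred D²) 0 ⟩
      ⟦ k * k * q /1+ pred D² * 1 ⟧
        ≡⟨ cong (λ c → ⟦ k * k * q /1+ c ⟧) (*-identityʳ (pred D²)) ⟩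
      ⟦ k * k * q /1+ pred D² ⟧ ∎
      where open ℚᵘ.≃-Reasoning

  scaled-nonneg : ∀ k → 0ℚ ℚ.≤ scaled k
  scaled-nonneg k = ℚ.toℚᵘ-cancel-≤ (ℚᵘ.≤-respʳ-≃ (ℚᵘ.≃-sym (toℚᵘ-/ k Dm)) (⟦⟧-≤ z≤n))

  scaled²*q≤ : ∀ k p q → k * k * q ≤ D² * p → scaled k ℚ.* scaled k ℚ.* (ℤ.+ q ℚ./ 1) ℚ.≤ ℤ.+ p ℚ./ 1
  scaled²*q≤ k p q le = ℚ.toℚᵘ-cancel-≤
    (ℚᵘ.≤-respˡ-≃ (ℚᵘ.≃-sym (scaled²*q≃ k q)) (ℚᵘ.≤-respʳ-≃ (ℚᵘ.≃-sym (toℚᵘ-/ p 0))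
      (⟦⟧-≤ (subst₂ _≤_ (sym (*-identityʳ _)) (sym (*-comm p D²)) le))))

  ≤scaled²*q : ∀ k p q → D² * p ≤ k * k * q → ℤ.+ p ℚ./ 1 ℚ.≤ scaled k ℚ.* scaled k ℚ.* (ℤ.+ q ℚ./ 1)
  ≤scaled²*q k p q le = ℚ.toℚᵘ-cancel-≤
    (ℚᵘ.≤-respʳ-≃ (ℚᵘ.≃-sym (scaled²*q≃ k q)) (ℚᵘ.≤-respˡ-≃ (ℚᵘ.≃-sym (toℚᵘ-/ p 0))
      (⟦⟧-≤ (subst₂ _≤_ (sym (*-comm p D²)) (sym (*-identityʳ _)) le))))

  sumℚ-scaled : ∀ ks → toℚᵘ (sumℚ (map scaled ks)) ℚᵘ.≃ ⟦ sum ks /1+ Dm ⟧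
  sumℚ-scaled []       = *≡* refl
  sumℚ-scaled (k ∷ ks) = ℚᵘ.≃-trans (ℚ.toℚᵘ-homo-+ (scaled k) _)
    (ℚᵘ.≃-trans (ℚᵘ.+-cong (toℚᵘ-/ k Dm) (sumℚ-scaled ks)) (⟦⟧-+ k (sum ks) Dm))

  sumℚ-scaled-< : ∀ ks ls → sum ks < sum ls → sumℚ (map scaled ks) ℚ.< sumℚ (map scaled ls)
  sumℚ-scaled-< ks ls lt = ℚ.toℚᵘ-cancel-<
    (ℚᵘ.<-respˡ-≃ (ℚᵘ.≃-sym (sumℚ-scaled ks)) (ℚᵘ.<-respʳ-≃ (ℚᵘ.≃-sym (sumℚ-scaled ls)) (⟦⟧-< (*-monoˡ-< D lt))))

  scaledSqrtᵖ : ℕ × ℕ → ℕ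
  scaledSqrtᵖ (p , q) = scaledSqrt p q

  <√-by-scaledSqrt : ∀ xs ys → All (λ x → 1 ≤ proj₂ x) xs →
    sum (map (suc ∘ scaledSqrtᵖ) xs) < sum (map scaledSqrtᵖ ys) → xs <√ ys
  <√-by-scaledSqrt xs ys q≥1 lt =
      map (scaled ∘ suc ∘ scaledSqrtᵖ) xs , map (scaled ∘ scaledSqrtᵖ) ys
    , All⇒Pointwise-map (All.map (λ {x} → upper {x}) q≥1) , All⇒Pointwise-map (All.universal lower ys)
    , subst₂ ℚ._<_ (cong sumℚ (sym (map-∘ xs))) (cong sumℚ (sym (map-∘ ys)))
             (sumℚ-scaled-< (map (suc ∘ scaledSqrtᵖ) xs) (map scaledSqrtᵖ ys) lt)
    where
    All⇒Pointwise-map : ∀ {A B : Set} {R : A → B → Set} {f : A → B} {zs} →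
                        All (λ z → R z (f z)) zs → Pointwise R zs (map f zs)
    All⇒Pointwise-map []       = []
    All⇒Pointwise-map (r ∷ rs) = r ∷ All⇒Pointwise-map rs
    upper : ∀ {x} → 1 ≤ proj₂ x → UpperSqrt x (scaled (suc (scaledSqrtᵖ x)))
    upper {p , suc r} _ = scaled-nonneg k , ≤scaled²*q k p (suc r) (<⇒≤ (<[1+scaledSqrt]²*q p r))
      where k = suc (scaledSqrt p (suc r))
    lower : ∀ x → LowerSqrt x (scaled (scaledSqrtᵖ x))
    lower (p , q) = inj₂ (scaled²*q≤ (scaledSqrt p q) p q (scaledSqrt²*q≤ p q))

sum-map-tabulate : ∀ {A : Set} {n} (f : Fin n → A) (g : A → ℕ) → sum (map g (tabulate f)) ≡ ∑[ i < n ] g (f i)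
sum-map-tabulate {n = zero}  f g = refl
sum-map-tabulate {n = suc n} f g = cong (g (f fzero) +_) (sum-map-tabulate (f ∘ fsuc) g)

sum-map-concatMap : ∀ {A B : Set} (g : B → ℕ) (f : A → List B) xs →
                    sum (map g (concatMap f xs)) ≡ sum (map (λ x → sum (map g (f x))) xs)
sum-map-concatMap g f []       = refl
sum-map-concatMap g f (x ∷ xs) = begin
  sum (map g (f x ++ concatMap f xs))                         ≡⟨ cong sum (map-++ g (f x) _) ⟩
  sum (map g (f x) ++ map g (concatMap f xs))                 ≡⟨ sum-++ (map g (f x)) _ ⟩
  sum (map g (f x)) + sum (map g (concatMap f xs))            ≡⟨ cong (sum (map g (f x)) +_) (sum-map-concatMap g f xs) ⟩
  sum (map g (f x)) + sum (map (λ x → sum (map g (f x))) xs)  ∎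
  where open ≡-Reasoning

∑-mono-≤ : ∀ {n} {f g : Fin n → ℕ} → (∀ i → f i ≤ g i) → ∑[ i < n ] f i ≤ ∑[ i < n ] g i
∑-mono-≤ {zero}  f≤g = z≤n
∑-mono-≤ {suc n} f≤g = +-mono-≤ (f≤g fzero) (∑-mono-≤ (f≤g ∘ fsuc))

∑-≤-* : ∀ {n} {f : Fin n → ℕ} c → (∀ i → f i ≤ c) → ∑[ i < n ] f i ≤ n * c
∑-≤-* {zero}  c f≤c = z≤n
∑-≤-* {suc n} c f≤c = +-mono-≤ (f≤c fzero) (∑-≤-* c (λ i → f≤c (fsuc i)))

≤-∑ : ∀ {n} (f : Fin n → ℕ) i → f i ≤ ∑[ u < n ] f u
≤-∑ f fzero    = m≤m+n _ _
≤-∑ f (fsuc i) = ≤-trans (≤-∑ (λ u → f (fsuc u)) i) (m≤n+m _ (f fzero))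

∑-delta : ∀ {n} (i : Fin n) (f : Fin n → ℕ) → ∑[ u < n ] (if ⌊ u ≟ i ⌋ then f u else 0) ≡ f i
∑-delta {suc n} fzero    f = trans (cong (f fzero +_) (sum-replicate-zero n)) (+-identityʳ (f fzero))
∑-delta {suc n} (fsuc i) f =
  trans (sum-cong-≗ (λ u → cong (λ b → if b then f (fsuc u) else 0) (⌊fsuc≟fsuc⌋ u)))
        (∑-delta i (λ u → f (fsuc u)))
  where
  ⌊fsuc≟fsuc⌋ : ∀ u → ⌊ fsuc u ≟ fsuc i ⌋ ≡ ⌊ u ≟ i ⌋
  ⌊fsuc≟fsuc⌋ u with u ≟ i
  ... | yes _ = refl
  ... | no _  = refl

∑²-distrib-+ : ∀ {n} (f g : Fin n → Fin n → ℕ) →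
  ∑[ u < n ] ∑[ v < n ] (f u v + g u v) ≡ ∑[ u < n ] ∑[ v < n ] f u v + ∑[ u < n ] ∑[ v < n ] g u v
∑²-distrib-+ {n} f g = trans (sum-cong-≗ (λ u → ∑-distrib-+ (f u) (g u)))
                             (∑-distrib-+ (λ u → ∑[ v < n ] f u v) (λ u → ∑[ v < n ] g u v))

∑²-mono-≤ : ∀ {n} {f g : Fin n → Fin n → ℕ} → (∀ u v → f u v ≤ g u v) →
  ∑[ u < n ] ∑[ v < n ] f u v ≤ ∑[ u < n ] ∑[ v < n ] g u v
∑²-mono-≤ f≤g = ∑-mono-≤ (λ u → ∑-mono-≤ (f≤g u))

∑-delta² : ∀ {n} (i j : Fin n) (f : Fin n → Fin n → ℕ) →
           ∑[ u < n ] ∑[ v < n ] (if ⌊ u ≟ i ⌋ then (if ⌊ v ≟ j ⌋ then f u v else 0) else 0) ≡ f i j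
∑-delta² {n} i j f = trans (sum-cong-≗ ∑-if) (trans (∑-delta i (λ u → ∑[ v < n ] (if ⌊ v ≟ j ⌋ then f u v else 0)))
                                                  (∑-delta j (f i)))
  where
  ∑-if : ∀ u → ∑[ v < n ] (if ⌊ u ≟ i ⌋ then (if ⌊ v ≟ j ⌋ then f u v else 0) else 0)
             ≡ (if ⌊ u ≟ i ⌋ then ∑[ v < n ] (if ⌊ v ≟ j ⌋ then f u v else 0) else 0)
  ∑-if u with ⌊ u ≟ i ⌋
  ... | true  = refl
  ... | false = sum-replicate-zero n

𝟙 : Bool → ℕ
𝟙 b = if b then 1 else 0

𝟙≤1 : ∀ b → 𝟙 b ≤ 1
𝟙≤1 true  = ≤-refl
𝟙≤1 false = z≤n

module _ {n} (K : Graph n) where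

  degree≡∑ : ∀ v → degree K v ≡ ∑[ u < n ] 𝟙 (adj K v u)
  degree≡∑ v = sum-map-tabulate (λ u → u) (λ u → 𝟙 (adj K v u))

  ∑-adj-const : ∀ v c → ∑[ u < n ] (if adj K v u then c else 0) ≡ degree K v * c
  ∑-adj-const v c = begin
    ∑[ u < n ] (if adj K v u then c else 0)  ≡⟨ sum-cong-≗ (λ u → if-as-* (adj K v u)) ⟩
    ∑[ u < n ] (𝟙 (adj K v u) * c)           ≡⟨ *-distribʳ-sum c (λ u → 𝟙 (adj K v u)) ⟨
    (∑[ u < n ] 𝟙 (adj K v u)) * c           ≡⟨ cong (_* c) (degree≡∑ v) ⟨
    degree K v * c                           ∎
    where
    open ≡-Reasoning
    if-as-* : ∀ b → (if b then c else 0) ≡ 𝟙 b * c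
    if-as-* true  = sym (*-identityˡ c)
    if-as-* false = refl

  1≤degree : ∀ {v u} → adj K v u ≡ true → 1 ≤ degree K v
  1≤degree {v} {u} vu∈K = subst (1 ≤_) (sym (degree≡∑ v))
    (≤-trans (≤-reflexive (cong 𝟙 (sym vu∈K))) (≤-∑ _ u))

  degree≤n : ∀ v → degree K v ≤ n
  degree≤n v = subst₂ _≤_ (sym (degree≡∑ v)) (*-identityʳ n) (∑-≤-* 1 (λ u → 𝟙≤1 (adj K v u)))

  arcSum : (Fin n → Fin n → ℕ) → ℕ
  arcSum f = ∑[ u < n ] ∑[ v < n ] (if adj K u v then f u v else 0)

  arcSum-+ : ∀ f g → arcSum (λ u v → f u v + g u v) ≡ arcSum f + arcSum g
  arcSum-+ f g = trans (sum-cong-≗ (λ u → sum-cong-≗ (λ v → if-+ (adj K u v))))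
                       (∑²-distrib-+ (λ u v → if adj K u v then f u v else 0) (λ u v → if adj K u v then g u v else 0))
    where
    if-+ : ∀ {x y} b → (if b then x + y else 0) ≡ (if b then x else 0) + (if b then y else 0)
    if-+ true  = refl
    if-+ false = refl

  arcSum-source : ∀ (c : Fin n → ℕ) → arcSum (λ u v → c u) ≡ ∑[ u < n ] (degree K u * c u)
  arcSum-source c = sum-cong-≗ (λ u → ∑-adj-const u (c u))

  arcSum-target : ∀ (c : Fin n → ℕ) → arcSum (λ u v → c v) ≡ arcSum (λ u v → c u)
  arcSum-target c = trans (∑-comm (λ u v → if adj K u v then c v else 0))
                          (sum-cong-≗ (λ v → sum-cong-≗ (λ u → cong (λ b → if b then c v else 0) (adj-sym K u v))))

  arcSum-1≤n² : arcSum (λ _ _ → 1) ≤ n * n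
  arcSum-1≤n² = ∑-≤-* n (λ u → ≤-trans (∑-≤-* 1 (λ v → 𝟙≤1 (adj K u v))) (≤-reflexive (*-identityʳ n)))

  private
    _≺_ : Fin n → Fin n → Bool
    u ≺ v = toℕ u <ᵇ toℕ v

    candidate : Fin n → Fin n → List (Fin n × Fin n)
    candidate u v = if u ≺ v ∧ adj K u v then (u , v) ∷ [] else []

    edge-indicator : ∀ h u v → sum (map h (candidate u v)) ≡ (if u ≺ v ∧ adj K u v then h (u , v) else 0)
    edge-indicator h u v with u ≺ v ∧ adj K u v
    ... | true  = +-identityʳ _
    ... | false = refl

    split-by-order : ∀ u v x → (if adj K u v then x else 0)
                             ≡ (if u ≺ v ∧ adj K u v then x else 0) + (if v ≺ u ∧ adj K u v then x else 0)
    split-by-order u v x with u ≺ v in u≺v | v ≺ u in v≺u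
    ... | true  | true  = contradiction (<ᵇ⇒< (toℕ v) (toℕ u) (subst T (sym v≺u) _))
                                        (<⇒≯ (<ᵇ⇒< (toℕ u) (toℕ v) (subst T (sym u≺v) _)))
    ... | true  | false = sym (+-identityʳ _)
    ... | false | true  = refl
    ... | false | false with toℕ-injective {i = u} {j = v} (≤-antisym (≮⇒≥ (λ v<u → subst T v≺u (<⇒<ᵇ v<u)))
                                                      (≮⇒≥ (λ u<v → subst T u≺v (<⇒<ᵇ u<v))))
    ...   | refl rewrite adj-irr K u = refl

  sum-edges : ∀ h → sum (map h (edges K)) ≡ ∑[ u < n ] ∑[ v < n ] (if u ≺ v ∧ adj K u v then h (u , v) else 0)
  sum-edges h = begin
    sum (map h (edges K))
      ≡⟨ sum-map-concatMap h _ (allFin n) ⟩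
    sum (map (λ u → sum (map h (concatMap (candidate u) (allFin n)))) (allFin n))
      ≡⟨ sum-map-tabulate (λ u → u) (λ u → sum (map h (concatMap (candidate u) (allFin n)))) ⟩
    ∑[ u < n ] sum (map h (concatMap (candidate u) (allFin n)))
      ≡⟨ sum-cong-≗ (λ u → trans (sum-map-concatMap h (candidate u) (allFin n))
                                 (sum-map-tabulate (λ v → v) (λ v → sum (map h (candidate u v))))) ⟩
    ∑[ u < n ] ∑[ v < n ] sum (map h (candidate u v))
      ≡⟨ sum-cong-≗ (λ u → sum-cong-≗ (edge-indicator h u)) ⟩
    ∑[ u < n ] ∑[ v < n ] (if u ≺ v ∧ adj K u v then h (u , v) else 0) ∎
    where open ≡-Reasoning

  arcSum≡2*sum-edges : ∀ h → (∀ u v → h (u , v) ≡ h (v , u)) →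
                       arcSum (λ u v → h (u , v)) ≡ 2 * sum (map h (edges K))
  arcSum≡2*sum-edges h h-sym = begin
    arcSum (λ u v → h (u , v))
      ≡⟨ sum-cong-≗ (λ u → trans (sum-cong-≗ (λ v → split-by-order u v (h (u , v)))) (∑-distrib-+ (F u) (F′ u))) ⟩
    ∑[ u < n ] (∑[ v < n ] F u v + ∑[ v < n ] F′ u v)
      ≡⟨ ∑-distrib-+ (λ u → ∑[ v < n ] F u v) (λ u → ∑[ v < n ] F′ u v) ⟩
    S + ∑[ u < n ] ∑[ v < n ] F′ u v
      ≡⟨ cong (S +_) (trans (∑-comm F′) (sum-cong-≗ (λ v → sum-cong-≗ (λ u → flip v u)))) ⟩
    S + S
      ≡⟨ cong (S +_) (sym (+-identityʳ S)) ⟩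
    2 * S
      ≡⟨ cong (2 *_) (sum-edges h) ⟨
    2 * sum (map h (edges K)) ∎
    where
    open ≡-Reasoning
    F F′ : Fin n → Fin n → ℕ
    F  u v = if u ≺ v ∧ adj K u v then h (u , v) else 0
    F′ u v = if v ≺ u ∧ adj K u v then h (u , v) else 0
    S = ∑[ u < n ] ∑[ v < n ] F u v
    flip : ∀ v u → F′ u v ≡ F v u
    flip v u = cong₂ (λ b x → if v ≺ u ∧ b then x else 0) (adj-sym K u v) (h-sym u v)

  All-edges : ∀ {P : Fin n × Fin n → Set} → (∀ u v → adj K u v ≡ true → P (u , v)) → All P (edges K)
  All-edges {P} P-arcs = concat⁺ (map⁺ (tabulate⁺ λ u → concat⁺ (map⁺ (tabulate⁺ λ v → All-candidate u v))))
    where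
    All-candidate : ∀ u v → All P (candidate u v)
    All-candidate u v with u ≺ v | adj K u v in uv∈K
    ... | true  | true  = P-arcs u v uv∈K ∷ []
    ... | true  | false = []
    ... | false | _     = []

3≤a+b : ∀ {a b} → 1 ≤ a → 1 ≤ b → ¬ (a ≡ 1 × b ≡ 1) → 3 ≤ a + b
3≤a+b {suc zero}    {suc zero}    _ _ not-both-1 = contradiction (refl , refl) not-both-1
3≤a+b {suc zero}    {suc (suc b)} _ _ _ = s≤s (s≤s (s≤s z≤n))
3≤a+b {suc (suc a)} {suc b}       _ _ _ = s≤s (s≤s (≤-trans (s≤s z≤n) (m≤n+m (suc b) a)))

3≤degree+degree : ∀ {n} {K : Graph n} → NoIsolatedEdge K → ∀ {u v} → adj K u v ≡ true → 3 ≤ degree K u + degree K v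
3≤degree+degree {K = K} no-isolated {u} {v} uv∈K =
  3≤a+b (1≤degree K uv∈K) (1≤degree K (trans (adj-sym K v u) uv∈K)) (no-isolated u v uv∈K)

module EdgeDeletion {n} (G : Graph n) {i j : Fin n} (ij∈G : IsEdge G i j) where

  H : Graph n
  H = deleteEdge G i j

  i≢j : i ≢ j
  i≢j refl with trans (sym (adj-irr G i)) ij∈G
  ... | ()

  private
    ⌊≟⌋-self : ∀ (x : Fin n) → ⌊ x ≟ x ⌋ ≡ true
    ⌊≟⌋-self x with x ≟ x
    ... | yes _ = refl
    ... | no x≢x = contradiction refl x≢x

    ⌊≟⌋-≢ : ∀ {x y : Fin n} → x ≢ y → ⌊ x ≟ y ⌋ ≡ false
    ⌊≟⌋-≢ {x} {y} x≢y with x ≟ y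
    ... | yes x≡y = contradiction x≡y x≢y
    ... | no _    = refl

  adj-H-i : ∀ u → adj H i u ≡ adj G i u ∧ not ⌊ u ≟ j ⌋
  adj-H-i u rewrite ⌊≟⌋-self i | ⌊≟⌋-≢ i≢j = cong (λ b → adj G i u ∧ not b) (∨-identityʳ _)

  adj-H-j : ∀ u → adj H j u ≡ adj G j u ∧ not ⌊ u ≟ i ⌋
  adj-H-j u rewrite ⌊≟⌋-self j | ⌊≟⌋-≢ (i≢j ∘ sym) = refl

  adj-H-other : ∀ {w} u → w ≢ i → w ≢ j → adj H w u ≡ adj G w u
  adj-H-other u w≢i w≢j rewrite ⌊≟⌋-≢ w≢i | ⌊≟⌋-≢ w≢j = ∧-identityʳ _

  ij∉H : adj H i j ≡ false
  ij∉H = trans (adj-H-i j) (trans (cong (λ b → adj G i j ∧ not b) (⌊≟⌋-self j)) (∧-zeroʳ _))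

  ji∉H : adj H j i ≡ false
  ji∉H = trans (adj-sym H j i) ij∉H

  private
    degree-drop : ∀ {w o} → (∀ u → adj H w u ≡ adj G w u ∧ not ⌊ u ≟ o ⌋) → adj G w o ≡ true →
                  degree G w ≡ suc (degree H w)
    degree-drop {w} {o} adj-H-w wo∈G = begin
      degree G w
        ≡⟨ degree≡∑ G w ⟩
      ∑[ u < n ] 𝟙 (adj G w u)
        ≡⟨ sum-cong-≗ split ⟩
      ∑[ u < n ] (𝟙 (adj H w u) + (if ⌊ u ≟ o ⌋ then 𝟙 (adj G w u) else 0))
        ≡⟨ ∑-distrib-+ (λ u → 𝟙 (adj H w u)) (λ u → if ⌊ u ≟ o ⌋ then 𝟙 (adj G w u) else 0) ⟩
      ∑[ u < n ] 𝟙 (adj H w u) + ∑[ u < n ] (if ⌊ u ≟ o ⌋ then 𝟙 (adj G w u) else 0)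
        ≡⟨ cong₂ _+_ (sym (degree≡∑ H w)) (∑-delta o (λ u → 𝟙 (adj G w u))) ⟩
      degree H w + 𝟙 (adj G w o)
        ≡⟨ cong (λ b → degree H w + 𝟙 b) wo∈G ⟩
      degree H w + 1
        ≡⟨ +-comm (degree H w) 1 ⟩
      suc (degree H w) ∎
      where
      open ≡-Reasoning
      split : ∀ u → 𝟙 (adj G w u) ≡ 𝟙 (adj H w u) + (if ⌊ u ≟ o ⌋ then 𝟙 (adj G w u) else 0)
      split u rewrite adj-H-w u with adj G w u | ⌊ u ≟ o ⌋
      ... | true  | true  = refl
      ... | true  | false = refl
      ... | false | true  = refl
      ... | false | false = refl

  degree-i : degree G i ≡ suc (degree H i)
  degree-i = degree-drop adj-H-i ij∈G

  degree-j : degree G j ≡ suc (degree H j)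
  degree-j = degree-drop adj-H-j (trans (adj-sym G j i) ij∈G)

  degree-other : ∀ {w} → w ≢ i → w ≢ j → degree H w ≡ degree G w
  degree-other {w} w≢i w≢j =
    trans (degree≡∑ H w) (trans (sum-cong-≗ (λ u → cong 𝟙 (adj-H-other u w≢i w≢j)))
                                (sym (degree≡∑ G w)))

  arc-avoids : ∀ {w v z} → adj H w v ≡ true → adj H w z ≡ false → v ≢ z
  arc-avoids wv∈H wz∉H refl with trans (sym wv∈H) wz∉H
  ... | ()

  removed : Fin n → Fin n → Bool
  removed u v = (⌊ u ≟ i ⌋ ∧ ⌊ v ≟ j ⌋) ∨ (⌊ u ≟ j ⌋ ∧ ⌊ v ≟ i ⌋)

  removed⇒adj : ∀ u v → removed u v ≡ true → adj G u v ≡ true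
  removed⇒adj u v uv-removed with u ≟ i | v ≟ j | u ≟ j | v ≟ i
  ... | yes refl | yes refl | _        | _        = ij∈G
  ... | _        | _        | yes refl | yes refl = trans (adj-sym G j i) ij∈G
  ... | yes _    | no _     | yes _    | no _     = case uv-removed of λ ()
  ... | yes _    | no _     | no _     | _        = case uv-removed of λ ()
  ... | no _     | _        | yes _    | no _     = case uv-removed of λ ()
  ... | no _     | _        | no _     | _        = case uv-removed of λ ()

  ∑-removed : ∀ f → ∑[ u < n ] ∑[ v < n ] (if removed u v then f u v else 0) ≡ f i j + f j i
  ∑-removed f = begin
    ∑[ u < n ] ∑[ v < n ] (if removed u v then f u v else 0)
      ≡⟨ sum-cong-≗ (λ u → trans (sum-cong-≗ (split u)) (∑-distrib-+ (δ i j u) (δ j i u))) ⟩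
    ∑[ u < n ] (∑[ v < n ] δ i j u v + ∑[ v < n ] δ j i u v)
      ≡⟨ ∑-distrib-+ (λ u → ∑[ v < n ] δ i j u v) (λ u → ∑[ v < n ] δ j i u v) ⟩
    ∑[ u < n ] ∑[ v < n ] δ i j u v + ∑[ u < n ] ∑[ v < n ] δ j i u v
      ≡⟨ cong₂ _+_ (∑-delta² i j f) (∑-delta² j i f) ⟩
    f i j + f j i ∎
    where
    open ≡-Reasoning
    δ : Fin n → Fin n → Fin n → Fin n → ℕ
    δ a b u v = if ⌊ u ≟ a ⌋ then (if ⌊ v ≟ b ⌋ then f u v else 0) else 0
    split : ∀ u v → (if removed u v then f u v else 0) ≡ δ i j u v + δ j i u v
    split u v with u ≟ i | u ≟ j
    ... | yes refl | yes refl = contradiction refl i≢j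
    ... | yes _    | no _     with ⌊ v ≟ j ⌋
    ...   | true  = sym (+-identityʳ _)
    ...   | false = refl
    split u v | no _ | yes _ with ⌊ v ≟ i ⌋
    ...   | true  = refl
    ...   | false = refl
    split u v | no _ | no _ = refl

module _ {n} (G : Graph n) {i j : Fin n} (ij∈G : IsEdge G i j)
         (H-no-isolated : NoIsolatedEdge (deleteEdge G i j)) where

  open EdgeDeletion G ij∈G
  open Precision (n * (n * n + 2 * n + 3))

  σ : Graph n → Fin n → Fin n → ℕ
  σ K u v = term (degree K u) (degree K v)

  σ-sym : ∀ K u v → σ K u v ≡ σ K v u
  σ-sym K u v = term-comm (degree K u) (degree K v)

  arc-from-endpoint : ∀ {w v} → degree G w ≡ suc (degree H w) → adj H w i ≡ false → adj H w j ≡ false →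
                      adj H w v ≡ true → σ H w v ≤ σ G w v + slope (degree G w)
  arc-from-endpoint {w} {v} w-drops wi∉H wj∉H wv∈H =
    subst₂ (λ d e → σ H w v ≤ term d e + slope d)
           (sym w-drops) (degree-other (arc-avoids wv∈H wi∉H) (arc-avoids wv∈H wj∉H))
           (term≤term[1+a]+slope (1≤degree H wv∈H) (1≤degree H (trans (adj-sym H v w) wv∈H))
                                 (3≤degree+degree {K = H} H-no-isolated wv∈H))

  arc-to-endpoint : ∀ {w u} → degree G w ≡ suc (degree H w) → adj H w i ≡ false → adj H w j ≡ false →
                    adj H u w ≡ true → σ H u w ≤ σ G u w + slope (degree G w)
  arc-to-endpoint {w} {u} w-drops wi∉H wj∉H uw∈H =
    subst₂ (λ a b → a ≤ b + slope (degree G w)) (σ-sym H w u) (σ-sym G w u)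
           (arc-from-endpoint w-drops wi∉H wj∉H (trans (adj-sym H w u) uw∈H))

  endpoint-loss : ℕ
  endpoint-loss = degree H i * slope (degree G i) + degree H j * slope (degree G j)

  allowance : Fin n → Fin n → ℕ
  allowance a w = if ⌊ w ≟ a ⌋ then slope (degree G a) else 0

  slope≤allowance : ∀ a → slope (degree G a) ≤ allowance a a
  slope≤allowance a with a ≟ a
  ... | yes _   = ≤-refl
  ... | no a≢a = contradiction refl a≢a

  loss : Fin n → ℕ
  loss w = allowance i w + allowance j w

  slope≤loss-i : slope (degree G i) ≤ loss i
  slope≤loss-i = ≤-trans (slope≤allowance i) (m≤m+n _ (allowance j i))

  slope≤loss-j : slope (degree G j) ≤ loss j
  slope≤loss-j = ≤-trans (slope≤allowance j) (m≤n+m _ (allowance i j))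

  arc-loss : ∀ u v → adj H u v ≡ true → σ H u v ≤ σ G u v + (loss u + loss v)
  arc-loss u v uv∈H = by-endpoints (u ≟ i) (u ≟ j) (v ≟ i) (v ≟ j)
    where
    -- Deciding the equalities outside the goal keeps them from being abstracted inside degree H.
    by-endpoints : Dec (u ≡ i) → Dec (u ≡ j) → Dec (v ≡ i) → Dec (v ≡ j) → σ H u v ≤ σ G u v + (loss u + loss v)
    by-endpoints (yes refl) _ _ _ =
      ≤-trans (arc-from-endpoint degree-i (adj-irr H i) ij∉H uv∈H)
              (+-monoʳ-≤ (σ G u v) (≤-trans slope≤loss-i (m≤m+n (loss i) (loss v))))
    by-endpoints (no _) (yes refl) _ _ =
      ≤-trans (arc-from-endpoint degree-j ji∉H (adj-irr H j) uv∈H)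
              (+-monoʳ-≤ (σ G u v) (≤-trans slope≤loss-j (m≤m+n (loss j) (loss v))))
    by-endpoints (no _) (no _) (yes refl) _ =
      ≤-trans (arc-to-endpoint degree-i (adj-irr H i) ij∉H uv∈H)
              (+-monoʳ-≤ (σ G u v) (≤-trans slope≤loss-i (m≤n+m (loss i) (loss u))))
    by-endpoints (no _) (no _) (no _) (yes refl) =
      ≤-trans (arc-to-endpoint degree-j ji∉H (adj-irr H j) uv∈H)
              (+-monoʳ-≤ (σ G u v) (≤-trans slope≤loss-j (m≤n+m (loss j) (loss u))))
    by-endpoints (no u≢i) (no u≢j) (no v≢i) (no v≢j) =
      ≤-trans (≤-reflexive (cong₂ term (degree-other u≢i u≢j) (degree-other v≢i v≢j))) (m≤m+n _ _)

  arc-bound : ∀ u v → (if adj H u v then suc (σ H u v) else 0) + (if removed u v then σ G u v else 0)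
                      ≤ (if adj G u v then σ G u v else 0) + (if adj H u v then suc (loss u + loss v) else 0)
  arc-bound u v = kept-or-removed (adj G u v) (removed u v) (removed⇒adj u v) (arc-loss u v)
    where
    kept-or-removed : ∀ {s s′ ℓ} g r → (r ≡ true → g ≡ true) → (g ∧ not r ≡ true → s ≤ s′ + ℓ) →
      (if g ∧ not r then suc s else 0) + (if r then s′ else 0) ≤ (if g then s′ else 0) + (if g ∧ not r then suc ℓ else 0)
    kept-or-removed false true  r⇒g _ with r⇒g refl
    ... | ()
    kept-or-removed false false _ _ = z≤n
    kept-or-removed {s′ = s′} true true _ _ = ≤-reflexive (+-comm 0 s′)
    kept-or-removed {s} {s′} {ℓ} true false _ s≤s′+ℓ =
      subst₂ _≤_ (sym (+-identityʳ (suc s))) (sym (+-suc s′ ℓ)) (s≤s (s≤s′+ℓ refl))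

  arcSum-bound : arcSum H (λ u v → suc (σ H u v)) + (σ G i j + σ G j i)
                 ≤ arcSum G (σ G) + arcSum H (λ u v → suc (loss u + loss v))
  arcSum-bound = begin
    arcSum H (λ u v → suc (σ H u v)) + (σ G i j + σ G j i)
      ≡⟨ cong (arcSum H (λ u v → suc (σ H u v)) +_) (∑-removed (σ G)) ⟨
    arcSum H (λ u v → suc (σ H u v)) + ∑[ u < n ] ∑[ v < n ] (if removed u v then σ G u v else 0)
      ≡⟨ ∑²-distrib-+ (λ u v → if adj H u v then suc (σ H u v) else 0) (λ u v → if removed u v then σ G u v else 0) ⟨
    ∑[ u < n ] ∑[ v < n ] ((if adj H u v then suc (σ H u v) else 0) + (if removed u v then σ G u v else 0))
      ≤⟨ ∑²-mono-≤ arc-bound ⟩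
    ∑[ u < n ] ∑[ v < n ] ((if adj G u v then σ G u v else 0) + (if adj H u v then suc (loss u + loss v) else 0))
      ≡⟨ ∑²-distrib-+ (λ u v → if adj G u v then σ G u v else 0) (λ u v → if adj H u v then suc (loss u + loss v) else 0) ⟩
    arcSum G (σ G) + arcSum H (λ u v → suc (loss u + loss v)) ∎
    where open ≤-Reasoning

  ∑-degree*loss : ∑[ u < n ] (degree H u * loss u) ≡ endpoint-loss
  ∑-degree*loss = begin
    ∑[ u < n ] (degree H u * loss u)
      ≡⟨ sum-cong-≗ (λ u → *-distribˡ-+ (degree H u) (allowance i u) (allowance j u)) ⟩
    ∑[ u < n ] (degree H u * allowance i u + degree H u * allowance j u)
      ≡⟨ ∑-distrib-+ (λ u → degree H u * allowance i u) (λ u → degree H u * allowance j u) ⟩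
    ∑[ u < n ] (degree H u * allowance i u) + ∑[ u < n ] (degree H u * allowance j u)
      ≡⟨ cong₂ _+_ (collect i) (collect j) ⟩
    endpoint-loss ∎
    where
    open ≡-Reasoning
    collect : ∀ a → ∑[ u < n ] (degree H u * allowance a u) ≡ degree H a * slope (degree G a)
    collect a = trans (sum-cong-≗ (λ u → *-if {degree H u} ⌊ u ≟ a ⌋)) (∑-delta a (λ u → degree H u * slope (degree G a)))
      where
      *-if : ∀ {d} c → d * (if c then slope (degree G a) else 0) ≡ (if c then d * slope (degree G a) else 0)
      *-if {d} true  = refl
      *-if {d} false = *-zeroʳ d

  arcSum-loss : arcSum H (λ u v → suc (loss u + loss v)) ≤ n * n + 2 * endpoint-loss
  arcSum-loss = begin
    arcSum H (λ u v → 1 + (loss u + loss v))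
      ≡⟨ arcSum-+ H (λ _ _ → 1) (λ u v → loss u + loss v) ⟩
    arcSum H (λ _ _ → 1) + arcSum H (λ u v → loss u + loss v)
      ≤⟨ +-monoˡ-≤ _ (arcSum-1≤n² H) ⟩
    n * n + arcSum H (λ u v → loss u + loss v)
      ≡⟨ cong (n * n +_) (arcSum-+ H (λ u v → loss u) (λ u v → loss v)) ⟩
    n * n + (arcSum H (λ u v → loss u) + arcSum H (λ u v → loss v))
      ≡⟨ cong (λ x → n * n + (arcSum H (λ u v → loss u) + x)) (arcSum-target H loss) ⟩
    n * n + (arcSum H (λ u v → loss u) + arcSum H (λ u v → loss u))
      ≡⟨ cong (λ x → n * n + (x + x)) (trans (arcSum-source H loss) ∑-degree*loss) ⟩
    n * n + (endpoint-loss + endpoint-loss)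
      ≡⟨ cong (λ x → n * n + (endpoint-loss + x)) (+-identityʳ endpoint-loss) ⟨
    n * n + 2 * endpoint-loss ∎
    where open ≤-Reasoning

  n²+endpoint-loss<σ : n * n + endpoint-loss < σ G i j
  n²+endpoint-loss<σ rewrite degree-i | degree-j =
    subst (_< term (suc (degree H i)) (suc (degree H j))) (+-assoc (n * n) _ _)
          (n²+x*slope+y*slope<term n ≤-refl (degree H i) (degree H j)
            (subst (_≤ n) degree-i (degree≤n G i)) (subst (_≤ n) degree-j (degree≤n G j)))

  arcSum-< : arcSum H (λ u v → suc (σ H u v)) < arcSum G (σ G)
  arcSum-< = +-cancelʳ-< (2 * σ G i j) _ _ (begin-strict
    arcSum H (λ u v → suc (σ H u v)) + 2 * σ G i j
      ≡⟨ cong (λ x → arcSum H (λ u v → suc (σ H u v)) + (σ G i j + x)) (trans (+-identityʳ _) (σ-sym G i j)) ⟩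
    arcSum H (λ u v → suc (σ H u v)) + (σ G i j + σ G j i)
      ≤⟨ arcSum-bound ⟩
    arcSum G (σ G) + arcSum H (λ u v → suc (loss u + loss v))
      ≤⟨ +-monoʳ-≤ (arcSum G (σ G)) arcSum-loss ⟩
    arcSum G (σ G) + (n * n + 2 * endpoint-loss)
      ≤⟨ +-monoʳ-≤ (arcSum G (σ G)) (m+k≡n⇒m≤n (n * n) (regroup (n * n) endpoint-loss)) ⟩
    arcSum G (σ G) + 2 * (n * n + endpoint-loss)
      <⟨ +-monoʳ-< (arcSum G (σ G)) (*-monoʳ-< 2 n²+endpoint-loss<σ) ⟩
    arcSum G (σ G) + 2 * σ G i j ∎)
    where
    open ≤-Reasoning
    regroup : ∀ a l → a + 2 * l + a ≡ 2 * (a + l)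
    regroup = solve-∀

  edge-sums-< : sum (map (λ e → suc (σ H (proj₁ e) (proj₂ e))) (edges H))
                < sum (map (λ e → σ G (proj₁ e) (proj₂ e)) (edges G))
  edge-sums-< = *-cancelˡ-< 2 _ _ (subst₂ _<_
    (arcSum≡2*sum-edges H (λ e → suc (σ H (proj₁ e) (proj₂ e))) (λ u v → cong suc (σ-sym H u v)))
    (arcSum≡2*sum-edges G (λ e → σ G (proj₁ e) (proj₂ e)) (σ-sym G))
    arcSum-<)

theorem2 : (n : ℕ) (G : Graph n) (i j : Fin n) →
           NoIsolatedEdge G → IsEdge G i j →
           NoIsolatedEdge (deleteEdge G i j) →
           ASO (deleteEdge G i j) <√ ASO G
theorem2 n G i j _ ij∈G H-no-isolated =
  <√-by-scaledSqrt (ASO H) (ASO G) denominators-positive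
    (subst₂ _<_ (cong sum (map-∘ (edges H))) (cong sum (map-∘ (edges G))) (edge-sums-< G ij∈G H-no-isolated))
  where
  open Precision (n * (n * n + 2 * n + 3))
  H = deleteEdge G i j
  denominators-positive : All (λ x → 1 ≤ proj₂ x) (ASO H)
  denominators-positive =
    map⁺ (All-edges H (λ u v uv∈H → ∸-monoˡ-≤ 2 (3≤degree+degree {K = H} H-no-isolated uv∈H)))
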